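{- Let $R$ be the Petersen graph. Then $\eta(R)=1/3$.
   Context: The Petersen graph is the generalized Petersen graph $G(5,2)$: vertices $u_0,\dots,u_4,v_0,\dots,v_4$ and edges $u_iu_{i+1}$, $u_iv_i$, $v_iv_{i+2}$ (indices mod $5$). For a graph $G=(V,E)$ admitting a perfect matching, a weight function is a map $w:E\to\mathbb{R}_{\ge 0}$ that is not identically zero. For $E'\subseteq E$ let $w(E')=\sum_{e\in E'}w(e)$. Let $M^*(G)$ be a maximum weight matching and $P^*(G)$ a maximum weight perfect matching of $G$. Define $\eta(G)=\min_{w} \frac{w(P^*(G))}{w(M^*(G))}$.
   Formalization: The weight functions take values in the nonnegative rationals rather than in ℝ≥0. -}

module Defs where

open import Data.Bool using (Bool; true; false; if_then_else_)
open import Data.Fin using (Fin; zero; suc)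
open import Data.List using (List; foldr; map; allFin; cartesianProductWith)
open import Data.Product using (_×_; _,_; ∃; ∃-syntax; Σ)
open import Data.Sum using (_⊎_)
open import Data.Integer using (+_)
open import Data.Rational using (ℚ; 0ℚ; _+_; _*_; _≤_; _/_)
open import Relation.Binary.PropositionalEquality using (_≡_; _≢_)

next : Fin 5 → Fin 5
next zero = suc zero
next (suc zero) = suc (suc zero)
next (suc (suc zero)) = suc (suc (suc zero))
next (suc (suc (suc zero))) = suc (suc (suc (suc zero)))
next (suc (suc (suc (suc zero)))) = zero

-- Petersen graph G(5,2).
-- Vertices: (zero , i) = u_i , (suc zero , i) = v_i.
Vertex : Set
Vertex = Fin 2 × Fin 5

u v : Fin 5 → Vertex
u i = (zero , i)
v i = (suc zero , i)

Edge : Set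
Edge = Fin 3 × Fin 5

ends : Edge → Vertex × Vertex
ends (zero , i) = (u i , u (next i))
ends (suc zero , i) = (u i , v i)
ends (suc (suc zero) , i) = (v i , v (next (next i)))

allEdges : List Edge
allEdges = cartesianProductWith _,_ (allFin 3) (allFin 5)

Incident : Vertex → Edge → Set
Incident x e with ends e
... | (a , b) = (x ≡ a) ⊎ (x ≡ b)

EdgeSet : Set
EdgeSet = Edge → Bool

IsMatching : EdgeSet → Set
IsMatching M = ∀ e f x → M e ≡ true → M f ≡ true → Incident x e → Incident x f → e ≡ f

IsPerfectMatching : EdgeSet → Set
IsPerfectMatching M = IsMatching M × (∀ x → ∃[ e ] (M e ≡ true × Incident x e))

Weight : Set
Weight = Edge → ℚ

IsWeightFunction : Weight → Set
IsWeightFunction w = (∀ e → 0ℚ ≤ w e) × (∃[ e ] (w e ≢ 0ℚ))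

wsum : Weight → EdgeSet → ℚ
wsum w S = foldr _+_ 0ℚ (map (λ e → if S e then w e else 0ℚ) allEdges)

IsMaxWeightMatching : Weight → EdgeSet → Set
IsMaxWeightMatching w M = IsMatching M × (∀ M' → IsMatching M' → wsum w M' ≤ wsum w M)

IsMaxWeightPerfectMatching : Weight → EdgeSet → Set
IsMaxWeightPerfectMatching w P =
  IsPerfectMatching P × (∀ P' → IsPerfectMatching P' → wsum w P' ≤ wsum w P)

-- η(R) = r: r is the minimum over weight functions w of w(P*)/w(M*).
-- Since w(M*) > 0 for any weight function, the ratio w(P*)/w(M*) ≥ r
-- is written  r * w(M*) ≤ w(P*), and = r as w(P*) ≡ r * w(M*).
-- (w(P*), w(M*) do not depend on the choice of maximisers.)
IsEta : ℚ → Set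
IsEta r =
  (∀ w P M → IsWeightFunction w → IsMaxWeightPerfectMatching w P →
     IsMaxWeightMatching w M → r * wsum w M ≤ wsum w P)
  × (Σ Weight λ w → Σ EdgeSet λ P → Σ EdgeSet λ M →
       IsWeightFunction w × IsMaxWeightPerfectMatching w P ×
       IsMaxWeightMatching w M × (wsum w P ≡ r * wsum w M))

oneThird : ℚ
oneThird = + 1 / 3

{-# OPTIONS --safe #-}
module Submission where

-- Lower bound: the Petersen graph has six perfect matchings (the five spokes u_i v_i, and for each i
-- the one whose only spoke is u_i v_i) and together they cover every edge exactly twice. Summing
-- them gives 6 w(P*) ≥ 2 w(E) ≥ 2 w(M*) for every nonnegative weight w.
-- Upper bound: u₀u₁, u₃v₃, v₂v₄ form a matching, but no perfect matching contains two of them, as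
-- propagating the forced edges at u₂, u₄, v₀ shows. With weight 1 on these three edges and 0
-- elsewhere, w(P*) = 1 and w(M*) = 3.

open import Algebra.Bundles using (CommutativeMonoid)
open import Data.Bool using (Bool; true; false; if_then_else_)
open import Data.Bool.Properties using () renaming (_≟_ to _≟ᵇ_)
open import Data.Empty using (⊥; ⊥-elim)
open import Data.Fin using (Fin; zero; suc; #_)
open import Data.Fin.Properties using (all?; any?) renaming (_≟_ to _≟ᶠ_)
open import Data.Integer as ℤ using ()
open import Data.List using (List; []; _∷_; foldr; map; allFin; length; filterᵇ; filter)
open import Data.List.Membership.Propositional using (_∈_; lose)
open import Data.List.Membership.Propositional.Properties
  using (∈-allFin; ∈-cartesianProduct⁺; ∈-filter⁺)
open import Data.List.Relation.Unary.All as All using (All; []; _∷_)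
open import Data.List.Relation.Unary.All.Properties using (map⁺)
open import Data.List.Relation.Unary.Any using (Any; here; there)
open import Data.List.Relation.Unary.Unique.Propositional using (Unique; []; _∷_)
open import Data.List.Relation.Unary.Unique.Propositional.Properties using (allFin⁺; cartesianProduct⁺)
open import Data.Nat using (zero; suc) renaming (_≟_ to _≟ℕ_)
open import Data.Product using (_×_; _,_; ∃; ∃-syntax; proj₁)
open import Data.Product.Properties using (≡-dec)
open import Data.Rational using (ℚ; 0ℚ; 1ℚ; _+_; _*_; _≤_; _/_; _≤?_; +-0-rawMonoid)
open import Data.Rational.Properties
  using (≤-refl; +-mono-≤; *-monoˡ-≤-nonNeg; +-identityˡ; +-identityʳ; +-0-commutativeMonoid; module ≤-Reasoning)
open import Data.Rational.Solver using (module +-*-Solver)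
open import Function using (_∘_)
open import Relation.Binary.Definitions using (DecidableEquality)
open import Relation.Binary.PropositionalEquality
  using (_≡_; _≢_; refl; sym; trans; cong; cong₂; module ≡-Reasoning)
open import Relation.Nullary.Decidable
  using (Dec; True; does; map′; from-yes; toWitness; dec-true; dec-false; _×-dec_; _⊎-dec_; _→-dec_; ¬?)

open import Algebra.Definitions.RawMonoid +-0-rawMonoid using () renaming (_×_ to _·_)
open import Algebra.Properties.CommutativeSemigroup
  (CommutativeMonoid.commutativeSemigroup +-0-commutativeMonoid) using (interchange)

open import Defs

private
  variable
    A B : Set
    f g : A → ℚ

sumOver : List A → (A → ℚ) → ℚ
sumOver xs f = foldr _+_ 0ℚ (map f xs)

sumOver-cong : ∀ xs → (∀ x → f x ≡ g x) → sumOver xs f ≡ sumOver xs g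
sumOver-cong [] _ = refl
sumOver-cong (x ∷ xs) f≗g rewrite f≗g x | sumOver-cong xs f≗g = refl

sumOver-zero : ∀ {xs} → All (λ x → f x ≡ 0ℚ) xs → sumOver xs f ≡ 0ℚ
sumOver-zero [] = refl
sumOver-zero (fx≡0 ∷ zeros) rewrite fx≡0 | sumOver-zero zeros = refl

sumOver-+ : ∀ xs → sumOver xs (λ x → f x + g x) ≡ sumOver xs f + sumOver xs g
sumOver-+ [] = refl
sumOver-+ {f = f} {g = g} (x ∷ xs) = begin
  (f x + g x) + sumOver xs (λ x → f x + g x)   ≡⟨ cong ((f x + g x) +_) (sumOver-+ xs) ⟩
  (f x + g x) + (sumOver xs f + sumOver xs g)  ≡⟨ interchange (f x) (g x) _ _ ⟩
  (f x + sumOver xs f) + (g x + sumOver xs g)  ∎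
  where open ≡-Reasoning

sumOver-· : ∀ n xs → sumOver xs (λ x → n · f x) ≡ n · sumOver xs f
sumOver-· {f = f} zero xs = sumOver-zero {f = λ x → 0 · f x} {xs} (All.tabulate λ _ → refl)
sumOver-· {f = f} (suc n) xs = trans (sumOver-+ xs) (cong (sumOver xs f +_) (sumOver-· n xs))

sumOver-comm : ∀ xs ys (h : A → B → ℚ) →
               sumOver xs (λ x → sumOver ys (h x)) ≡ sumOver ys (λ y → sumOver xs (λ x → h x y))
sumOver-comm [] ys h = sym (sumOver-zero {f = λ _ → 0ℚ} {ys} (All.tabulate λ _ → refl))
sumOver-comm (x ∷ xs) ys h =
  trans (cong (sumOver ys (h x) +_) (sumOver-comm xs ys h)) (sym (sumOver-+ ys))

sumOver-mono : ∀ xs → All (λ x → f x ≤ g x) xs → sumOver xs f ≤ sumOver xs g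
sumOver-mono [] [] = ≤-refl
sumOver-mono (_ ∷ xs) (fx≤gx ∷ rest) = +-mono-≤ fx≤gx (sumOver-mono xs rest)

sumOver-const : ∀ xs c → sumOver xs (λ (_ : A) → c) ≡ length xs · c
sumOver-const [] c = refl
sumOver-const (_ ∷ xs) c = cong (c +_) (sumOver-const xs c)

sumOver-count : ∀ (p : A → Bool) c xs →
                sumOver xs (λ x → if p x then c else 0ℚ) ≡ length (filterᵇ p xs) · c
sumOver-count p c [] = refl
sumOver-count p c (x ∷ xs) with p x
... | true = cong (c +_) (sumOver-count p c xs)
... | false = trans (+-identityˡ _) (sumOver-count p c xs)

sumOver-single : ∀ {xs x} → Unique xs → x ∈ xs → (∀ y → y ≢ x → f y ≡ 0ℚ) → sumOver xs f ≡ f x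
sumOver-single {f = f} {x = x} (x∉xs ∷ _) (here refl) off-x =
  trans (cong (f x +_) (sumOver-zero (All.map (λ x≢y → off-x _ (x≢y ∘ sym)) x∉xs))) (+-identityʳ (f x))
sumOver-single {f = f} {xs = y ∷ xs} (y∉xs ∷ unique) (there x∈xs) off-x = begin
  f y + sumOver xs f  ≡⟨ cong (_+ sumOver xs f) (off-x y (All.lookup y∉xs x∈xs)) ⟩
  0ℚ + sumOver xs f   ≡⟨ +-identityˡ _ ⟩
  sumOver xs f        ≡⟨ sumOver-single unique x∈xs off-x ⟩
  f _                 ∎
  where open ≡-Reasoning

·-monoʳ-≤ : ∀ n {p q} → p ≤ q → n · p ≤ n · q
·-monoʳ-≤ zero _ = ≤-refl
·-monoʳ-≤ (suc n) p≤q = +-mono-≤ p≤q (·-monoʳ-≤ n p≤q)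

≤-by-evaluation : ∀ {p q} {p≤q : True (p ≤? q)} → p ≤ q
≤-by-evaluation {p≤q = p≤q} = toWitness p≤q

2·p≤6·q⇒⅓p≤q : ∀ {p q} → 2 · p ≤ 6 · q → oneThird * p ≤ q
2·p≤6·q⇒⅓p≤q {p} {q} 2p≤6q = begin
  oneThird * p       ≡⟨ solve 1 (λ p → con oneThird :* p := con sixth :* (p :+ (p :+ con 0ℚ))) refl p ⟩
  sixth * (2 · p)    ≤⟨ *-monoˡ-≤-nonNeg sixth 2p≤6q ⟩
  sixth * (6 · q)    ≡⟨ solve 1 (λ q → con sixth :* (q :+ (q :+ (q :+ (q :+ (q :+ (q :+ con 0ℚ)))))) := q) refl q ⟩
  q                  ∎
  where
  open ≤-Reasoning
  open +-*-Solver
  sixth : ℚ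
  sixth = ℤ.+ 1 / 6

_≟ᵥ_ : DecidableEquality Vertex
_≟ᵥ_ = ≡-dec _≟ᶠ_ _≟ᶠ_

_≟ₑ_ : DecidableEquality Edge
_≟ₑ_ = ≡-dec _≟ᶠ_ _≟ᶠ_

open import Data.List.Membership.DecPropositional _≟ₑ_ using (_∈?_)

∀-pair? : ∀ {m n} {P : Fin m × Fin n → Set} → (∀ p → Dec (P p)) → Dec (∀ p → P p)
∀-pair? P? = map′ (λ h (i , j) → h i j) (λ h i j → h (i , j)) (all? λ i → all? λ j → P? (i , j))

∃-pair? : ∀ {m n} {P : Fin m × Fin n → Set} → (∀ p → Dec (P p)) → Dec (∃ P)
∃-pair? P? = map′ (λ (i , j , p) → (i , j) , p) (λ ((i , j) , p) → i , j , p)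
                  (any? λ i → any? λ j → P? (i , j))

∈-allEdges : ∀ e → e ∈ allEdges
∈-allEdges (k , i) = ∈-cartesianProduct⁺ (∈-allFin k) (∈-allFin i)

allEdges-unique : Unique allEdges
allEdges-unique = cartesianProduct⁺ (allFin⁺ 3) (allFin⁺ 5)

incident? : ∀ x e → Dec (Incident x e)
incident? x (zero , i) = (x ≟ᵥ u i) ⊎-dec (x ≟ᵥ u (next i))
incident? x (suc zero , i) = (x ≟ᵥ u i) ⊎-dec (x ≟ᵥ v i)
incident? x (suc (suc zero) , i) = (x ≟ᵥ v i) ⊎-dec (x ≟ᵥ v (next (next i)))

-- The quantifiers are reordered so that the decision procedure discards a pair (e , x)
-- before looking at f unless e ∈ M and x ∈ e.
isMatching? : ∀ M → Dec (IsMatching M)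
isMatching? M =
  map′ (λ h e f x Me Mf x∈e x∈f → h e Me x x∈e f Mf x∈f)
       (λ h e Me x x∈e f Mf x∈f → h e f x Me Mf x∈e x∈f)
    (∀-pair? λ e → (M e ≟ᵇ true) →-dec ∀-pair? λ x → incident? x e →-dec
     ∀-pair? λ f → (M f ≟ᵇ true) →-dec incident? x f →-dec (e ≟ₑ f))

isPerfectMatching? : ∀ M → Dec (IsPerfectMatching M)
isPerfectMatching? M =
  isMatching? M ×-dec (∀-pair? λ x → ∃-pair? λ e → (M e ≟ᵇ true) ×-dec incident? x e)

Adjacent : Edge → Edge → Set
Adjacent e f = e ≢ f × ∃[ x ] (Incident x e × Incident x f)

adjacent? : ∀ e f → Dec (Adjacent e f)
adjacent? e f = ¬? (e ≟ₑ f) ×-dec ∃-pair? λ x → incident? x e ×-dec incident? x f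

matching-excludes-adjacent : ∀ {M e f} → IsMatching M → M e ≡ true → M f ≡ true →
                             {True (adjacent? e f)} → ⊥
matching-excludes-adjacent {e = e} {f} matching Me Mf {adj} with toWitness adj
... | e≢f , x , x∈e , x∈f = e≢f (matching e f x Me Mf x∈e x∈f)

edgesAt : Vertex → List Edge
edgesAt x = filter (incident? x) allEdges

matched-at : ∀ {P} → IsPerfectMatching P → ∀ x → Any (λ e → P e ≡ true) (edgesAt x)
matched-at (_ , covered) x with covered x
... | e , Pe , x∈e = lose (∈-filter⁺ (incident? x) (∈-allEdges e) x∈e) Pe

_↾_ : Weight → EdgeSet → Weight
(w ↾ S) e = if S e then w e else 0ℚ

_+ʷ_ : Weight → Weight → Weight
(w +ʷ w′) e = w e + w′ e

wsum-≤-total : ∀ {w} → (∀ e → 0ℚ ≤ w e) → ∀ S → wsum w S ≤ sumOver allEdges w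
wsum-≤-total {w} nonneg S =
  sumOver-mono {f = w ↾ S} {g = w} allEdges (All.tabulate λ {e} _ → restricted-≤ (S e) (nonneg e))
  where
  restricted-≤ : ∀ b {x} → 0ℚ ≤ x → (if b then x else 0ℚ) ≤ x
  restricted-≤ true _ = ≤-refl
  restricted-≤ false 0≤x = 0≤x

wsum-+ʷ : ∀ w w′ S → wsum (w +ʷ w′) S ≡ wsum w S + wsum w′ S
wsum-+ʷ w w′ S = trans (sumOver-cong allEdges ↾-+) (sumOver-+ {f = w ↾ S} {g = w′ ↾ S} allEdges)
  where
  ↾-+ : ∀ e → ((w +ʷ w′) ↾ S) e ≡ (w ↾ S) e + (w′ ↾ S) e
  ↾-+ e with S e
  ... | true = refl
  ... | false = refl

wsum-double-counting : ∀ Ps k → (∀ e → length (filterᵇ (λ S → S e) Ps) ≡ k) →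
                       ∀ w → sumOver Ps (wsum w) ≡ k · sumOver allEdges w
wsum-double-counting Ps k cover w = begin
  sumOver Ps (wsum w)                                  ≡⟨ sumOver-comm Ps allEdges (w ↾_) ⟩
  sumOver allEdges (λ e → sumOver Ps (λ S → (w ↾ S) e))  ≡⟨ sumOver-cong allEdges count-e ⟩
  sumOver allEdges (λ e → k · w e)                     ≡⟨ sumOver-· {f = w} k allEdges ⟩
  k · sumOver allEdges w                               ∎
  where
  open ≡-Reasoning
  count-e : ∀ e → sumOver Ps (λ S → (w ↾ S) e) ≡ k · w e
  count-e e = trans (sumOver-count (λ S → S e) (w e) Ps) (cong (_· w e) (cover e))

⟦_⟧ : Bool → ℚ
⟦ b ⟧ = if b then 1ℚ else 0ℚ

pointMass : Edge → Weight
pointMass e e′ = ⟦ does (e ≟ₑ e′) ⟧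

wsum-pointMass : ∀ e S → wsum (pointMass e) S ≡ ⟦ S e ⟧
wsum-pointMass e S = begin
  wsum (pointMass e) S                 ≡⟨ sumOver-single allEdges-unique (∈-allEdges e) off-e ⟩
  (pointMass e ↾ S) e                  ≡⟨ cong (λ x → if S e then ⟦ x ⟧ else 0ℚ) (dec-true (e ≟ₑ e) refl) ⟩
  ⟦ S e ⟧                              ∎
  where
  open ≡-Reasoning
  off-e : ∀ e′ → e′ ≢ e → (pointMass e ↾ S) e′ ≡ 0ℚ
  off-e e′ e′≢e with S e′
  ... | true = cong ⟦_⟧ (dec-false (e ≟ₑ e′) (e′≢e ∘ sym))
  ... | false = refl

outer spoke inner : Fin 5 → Edge
outer i = (zero , i)
spoke i = (suc zero , i)
inner i = (suc (suc zero) , i)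

edgeSet : List Edge → EdgeSet
edgeSet es e = does (e ∈? es)

spokes : EdgeSet
spokes = edgeSet (map spoke (allFin 5))

spokeMatching : Fin 5 → EdgeSet
spokeMatching i =
  edgeSet (spoke i ∷ outer (next i) ∷ outer (next (next (next i)))
                   ∷ inner (next i) ∷ inner (next (next i)) ∷ [])

perfectMatchings : List EdgeSet
perfectMatchings = spokes ∷ map spokeMatching (allFin 5)

spokeMatching-perfect : ∀ i → IsPerfectMatching (spokeMatching i)
spokeMatching-perfect = from-yes (all? (isPerfectMatching? ∘ spokeMatching))

perfectMatchings-perfect : All IsPerfectMatching perfectMatchings
perfectMatchings-perfect =
  from-yes (isPerfectMatching? spokes) ∷ map⁺ (All.tabulate λ {i} _ → spokeMatching-perfect i)

perfectMatchings-double-cover : ∀ e → length (filterᵇ (λ S → S e) perfectMatchings) ≡ 2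
perfectMatchings-double-cover =
  from-yes (∀-pair? λ e → length (filterᵇ (λ S → S e) perfectMatchings) ≟ℕ 2)

⅓-wsum≤max-perfect-matching :
  ∀ w → (∀ e → 0ℚ ≤ w e) → ∀ P → (∀ P′ → IsPerfectMatching P′ → wsum w P′ ≤ wsum w P) →
  ∀ S → oneThird * wsum w S ≤ wsum w P
⅓-wsum≤max-perfect-matching w nonneg P maximal S = 2·p≤6·q⇒⅓p≤q {wsum w S} {wsum w P} (begin
  2 · wsum w S
    ≤⟨ ·-monoʳ-≤ 2 (wsum-≤-total nonneg S) ⟩
  2 · sumOver allEdges w
    ≡⟨ wsum-double-counting perfectMatchings 2 perfectMatchings-double-cover w ⟨
  sumOver perfectMatchings (wsum w)
    ≤⟨ sumOver-mono perfectMatchings (All.map (maximal _) perfectMatchings-perfect) ⟩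
  sumOver perfectMatchings (λ _ → wsum w P)
    ≡⟨ sumOver-const perfectMatchings (wsum w P) ⟩
  6 · wsum w P
    ∎)
  where open ≤-Reasoning

u₀u₁ u₃v₃ v₂v₄ : Edge
u₀u₁ = outer (# 0)
u₃v₃ = spoke (# 3)
v₂v₄ = inner (# 2)

-- edgesAt x lists the outer edges, then the spoke, then the inner edges at x, by increasing index.
module _ {P : EdgeSet} (perfect : IsPerfectMatching P) where

  private
    clash : ∀ {e f} → P e ≡ true → P f ≡ true → {True (adjacent? e f)} → ⊥
    clash = matching-excludes-adjacent (proj₁ perfect)

  u₀u₁-u₃v₃-apart : P u₀u₁ ≡ true → P u₃v₃ ≡ true → ⊥
  u₀u₁-u₃v₃-apart P-u₀u₁ P-u₃v₃ with matched-at perfect (u (# 2))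
  ... | here P-u₁u₂ = clash P-u₀u₁ P-u₁u₂
  ... | there (here P-u₂u₃) = clash P-u₃v₃ P-u₂u₃
  ... | there (there (here P-u₂v₂)) with matched-at perfect (u (# 4))
  ...   | here P-u₃u₄ = clash P-u₃v₃ P-u₃u₄
  ...   | there (here P-u₄u₀) = clash P-u₀u₁ P-u₄u₀
  ...   | there (there (here _)) with matched-at perfect (v (# 0))
  ...     | here P-u₀v₀ = clash P-u₀u₁ P-u₀v₀
  ...     | there (here P-v₀v₂) = clash P-u₂v₂ P-v₀v₂
  ...     | there (there (here P-v₃v₀)) = clash P-u₃v₃ P-v₃v₀

  u₀u₁-v₂v₄-apart : P u₀u₁ ≡ true → P v₂v₄ ≡ true → ⊥
  u₀u₁-v₂v₄-apart P-u₀u₁ P-v₂v₄ with matched-at perfect (u (# 2))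
  ... | here P-u₁u₂ = clash P-u₀u₁ P-u₁u₂
  ... | there (there (here P-u₂v₂)) = clash P-v₂v₄ P-u₂v₂
  ... | there (here P-u₂u₃) with matched-at perfect (u (# 4))
  ...   | here P-u₃u₄ = clash P-u₂u₃ P-u₃u₄
  ...   | there (here P-u₄u₀) = clash P-u₀u₁ P-u₄u₀
  ...   | there (there (here P-u₄v₄)) = clash P-v₂v₄ P-u₄v₄

  u₃v₃-v₂v₄-apart : P u₃v₃ ≡ true → P v₂v₄ ≡ true → ⊥
  u₃v₃-v₂v₄-apart P-u₃v₃ P-v₂v₄ with matched-at perfect (u (# 4))
  ... | here P-u₃u₄ = clash P-u₃v₃ P-u₃u₄
  ... | there (there (here P-u₄v₄)) = clash P-v₂v₄ P-u₄v₄
  ... | there (here P-u₄u₀) with matched-at perfect (v (# 0))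
  ...   | here P-u₀v₀ = clash P-u₄u₀ P-u₀v₀
  ...   | there (here P-v₀v₂) = clash P-v₂v₄ P-v₀v₂
  ...   | there (there (here P-v₃v₀)) = clash P-u₃v₃ P-v₃v₀

apartWeight : Weight
apartWeight = pointMass u₀u₁ +ʷ (pointMass u₃v₃ +ʷ pointMass v₂v₄)

apartWeight-isWeightFunction : IsWeightFunction apartWeight
apartWeight-isWeightFunction = from-yes (∀-pair? λ e → 0ℚ ≤? apartWeight e) , u₀u₁ , λ ()

wsum-apartWeight : ∀ S → wsum apartWeight S ≡ ⟦ S u₀u₁ ⟧ + (⟦ S u₃v₃ ⟧ + ⟦ S v₂v₄ ⟧)
wsum-apartWeight S = begin
  wsum apartWeight S
    ≡⟨ wsum-+ʷ (pointMass u₀u₁) (pointMass u₃v₃ +ʷ pointMass v₂v₄) S ⟩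
  wsum (pointMass u₀u₁) S + wsum (pointMass u₃v₃ +ʷ pointMass v₂v₄) S
    ≡⟨ cong₂ _+_ (wsum-pointMass u₀u₁ S) (wsum-+ʷ (pointMass u₃v₃) (pointMass v₂v₄) S) ⟩
  ⟦ S u₀u₁ ⟧ + (wsum (pointMass u₃v₃) S + wsum (pointMass v₂v₄) S)
    ≡⟨ cong (⟦ S u₀u₁ ⟧ +_) (cong₂ _+_ (wsum-pointMass u₃v₃ S) (wsum-pointMass v₂v₄ S)) ⟩
  ⟦ S u₀u₁ ⟧ + (⟦ S u₃v₃ ⟧ + ⟦ S v₂v₄ ⟧)
    ∎
  where open ≡-Reasoning

⟦⟧-at-most-one : ∀ a b c →
                 (a ≡ true → b ≡ true → ⊥) → (a ≡ true → c ≡ true → ⊥) → (b ≡ true → c ≡ true → ⊥) →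
                 ⟦ a ⟧ + (⟦ b ⟧ + ⟦ c ⟧) ≤ 1ℚ
⟦⟧-at-most-one true true _ ¬ab _ _ = ⊥-elim (¬ab refl refl)
⟦⟧-at-most-one true _ true _ ¬ac _ = ⊥-elim (¬ac refl refl)
⟦⟧-at-most-one _ true true _ _ ¬bc = ⊥-elim (¬bc refl refl)
⟦⟧-at-most-one true false false _ _ _ = ≤-by-evaluation
⟦⟧-at-most-one false true false _ _ _ = ≤-by-evaluation
⟦⟧-at-most-one false false true _ _ _ = ≤-by-evaluation
⟦⟧-at-most-one false false false _ _ _ = ≤-by-evaluation

apartMatching : EdgeSet
apartMatching = edgeSet (u₀u₁ ∷ u₃v₃ ∷ v₂v₄ ∷ [])

apartMatching-isMatching : IsMatching apartMatching
apartMatching-isMatching = from-yes (isMatching? apartMatching)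

apartWeight-perfect≤1 : ∀ P → IsPerfectMatching P → wsum apartWeight P ≤ 1ℚ
apartWeight-perfect≤1 P perfect = begin
  wsum apartWeight P                       ≡⟨ wsum-apartWeight P ⟩
  ⟦ P u₀u₁ ⟧ + (⟦ P u₃v₃ ⟧ + ⟦ P v₂v₄ ⟧)  ≤⟨ ⟦⟧-at-most-one _ _ _ (u₀u₁-u₃v₃-apart perfect)
                                                              (u₀u₁-v₂v₄-apart perfect)
                                                              (u₃v₃-v₂v₄-apart perfect) ⟩
  1ℚ                                       ∎
  where open ≤-Reasoning

proposition3p6 : IsEta oneThird
proposition3p6 =
  (λ w P M (nonneg , _) (_ , maximal) _ → ⅓-wsum≤max-perfect-matching w nonneg P maximal M)
  , apartWeight , spokeMatching (# 4) , apartMatching , apartWeight-isWeightFunction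
  , (spokeMatching-perfect (# 4) , apartWeight-perfect≤1)
  , (apartMatching-isMatching , λ M _ → wsum-≤-total (proj₁ apartWeight-isWeightFunction) M)
  , refl
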